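{- Every finite subset $A \subseteq \mathbb{Z} \setminus \{0\}$ has a valid ordering, i.e., there is an ordering $a_1, \ldots, a_{|A|}$ of the elements of $A$ such that the partial sums $a_1,\ a_1+a_2,\ \ldots,\ a_1+a_2+\cdots+a_{|A|}$ are pairwise distinct. -}

module Defs where

open import Data.Integer using (ℤ; _+_; 0ℤ)
open import Data.List using (List; []; _∷_; map)

partialSums : List ℤ → List ℤ
partialSums []       = []
partialSums (a ∷ as) = a ∷ map (a +_) (partialSums as)

-- Call an ordering good when its prefix sums, the empty one included, are
-- distinct. If sum A > 0, remove a positive x whose removal leaves a set A′ of
-- nonzero sum (or nothing) and put x in front of a good ordering of A′ with
-- prefix sums above −x: for sum A′ > 0 take one with nonnegative prefix sums
-- (induction), for sum A′ < 0 take such an ordering of −A′ and read it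
-- backwards, which reflects its prefix sums into [sum A′, ∞), and
-- x + sum A′ = sum A > 0. Negative sums are the mirror image, and for sum 0
-- a good ordering of A minus one element a, followed by a, is valid.

module Submission where

open import Defs
open import Data.Integer using (ℤ; 0ℤ; _+_; -_; _≤_; _<_; _<?_; _≟_)
open import Data.Integer.Properties
  using ( +-comm; +-assoc; +-identityˡ; +-identityʳ; +-0-isCommutativeMonoid; +-0-abelianGroup
        ; neg-distrib-+; neg-involutive; neg-injective; neg-mono-<
        ; ≤-refl; ≤-reflexive; <⇒≤; <⇒≢; ≮⇒≥; ≤∧≢⇒<; <-irrefl; <-cmp; ≤-<-trans; <-≤-trans
        ; +-monoˡ-≤; +-monoʳ-≤; +-monoˡ-< )
open import Algebra.Properties.AbelianGroup +-0-abelianGroup using (∙-cancelˡ; ∙-cancelʳ)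
open import Data.Integer.Tactic.RingSolver using (solve-∀)
open import Data.Nat using (zero; suc)
import Data.Nat.Properties as ℕ
open import Data.List using (List; []; _∷_; [_]; _∷ʳ_; map; foldr; reverse; length)
open import Data.List.Properties
  using (map-++; map-∘; map-cong; map-id; reverse-map; unfold-reverse; length-map)
open import Data.List.Relation.Unary.All as All using (All; []; _∷_)
import Data.List.Relation.Unary.All.Properties as All
open import Data.List.Relation.Unary.AllPairs using ([]; _∷_)
open import Data.List.Relation.Unary.Unique.Propositional using (Unique)
import Data.List.Relation.Unary.Unique.Propositional.Properties as Unique
open import Data.List.Relation.Binary.Permutation.Propositional
  using (_↭_; ↭-refl; ↭-prep; ↭-swap; ↭-sym; ↭-trans; ↭⇒↭ₛ)
open import Data.List.Relation.Binary.Permutation.Propositional.Properties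
  using (All-resp-↭; ↭-length; ↭-reverse; ∷↭∷ʳ)
import Data.List.Relation.Binary.Permutation.Propositional.Properties as Perm
open import Relation.Binary.PropositionalEquality
  using (_≡_; _≢_; refl; sym; trans; cong; cong₂; subst; setoid; module ≡-Reasoning)
open import Data.List.Relation.Binary.Permutation.Setoid.Properties (setoid ℤ)
  using (foldr-commMonoid) renaming (Unique-resp-↭ to Unique-resp-↭ₛ)
open import Data.Product using (Σ-syntax; ∃-syntax; ∃₂; _×_; _,_)
open import Function using (_∘_)
open import Relation.Binary.Definitions using (tri<; tri≈; tri>)
open import Relation.Nullary using (yes; no; contradiction)

sum : List ℤ → ℤ
sum = foldr _+_ 0ℤ

sum-↭ : ∀ {xs ys} → xs ↭ ys → sum xs ≡ sum ys
sum-↭ p = foldr-commMonoid +-0-isCommutativeMonoid (↭⇒↭ₛ p)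

sum-∷ʳ : ∀ xs y → sum (xs ∷ʳ y) ≡ sum xs + y
sum-∷ʳ xs y = trans (sym (sum-↭ (∷↭∷ʳ y xs))) (+-comm y (sum xs))

sum-map-neg : ∀ xs → sum (map -_ xs) ≡ - sum xs
sum-map-neg []       = refl
sum-map-neg (x ∷ xs) = trans (cong (- x +_) (sum-map-neg xs)) (sym (neg-distrib-+ x (sum xs)))

Unique-resp-↭ : ∀ {xs ys : List ℤ} → xs ↭ ys → Unique xs → Unique ys
Unique-resp-↭ p = Unique-resp-↭ₛ (↭⇒↭ₛ p)

map-neg-involutive : ∀ xs → map -_ (map -_ xs) ≡ xs
map-neg-involutive xs = trans (sym (map-∘ xs)) (trans (map-cong neg-involutive xs) (map-id xs))

prefixSums : List ℤ → List ℤ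
prefixSums σ = 0ℤ ∷ partialSums σ

prefixSums-∷ : ∀ x σ → prefixSums (x ∷ σ) ≡ 0ℤ ∷ map (x +_) (prefixSums σ)
prefixSums-∷ x σ = cong (λ y → 0ℤ ∷ y ∷ map (x +_) (partialSums σ)) (sym (+-identityʳ x))

partialSums-∷ʳ : ∀ σ y → partialSums (σ ∷ʳ y) ≡ partialSums σ ∷ʳ (sum σ + y)
partialSums-∷ʳ []      y = cong [_] (sym (+-identityˡ y))
partialSums-∷ʳ (x ∷ σ) y = cong (x ∷_) (begin
  map (x +_) (partialSums (σ ∷ʳ y))                ≡⟨ cong (map (x +_)) (partialSums-∷ʳ σ y) ⟩
  map (x +_) (partialSums σ ∷ʳ (sum σ + y))        ≡⟨ map-++ (x +_) (partialSums σ) _ ⟩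
  map (x +_) (partialSums σ) ∷ʳ (x + (sum σ + y))  ≡⟨ cong (_ ∷ʳ_) (sym (+-assoc x (sum σ) y)) ⟩
  map (x +_) (partialSums σ) ∷ʳ (x + sum σ + y)    ∎)
  where open ≡-Reasoning

mirror : List ℤ → List ℤ
mirror σ = reverse (map -_ σ)

mirror-↭ : ∀ {σ A} → σ ↭ map -_ A → mirror σ ↭ A
mirror-↭ {σ} {A} p =
  ↭-trans (↭-reverse (map -_ σ)) (subst (map -_ σ ↭_) (map-neg-involutive A) (Perm.map⁺ -_ p))

prefixSums-mirror : ∀ σ → prefixSums (mirror σ) ≡ map (_+ sum (mirror σ)) (reverse (prefixSums σ))
prefixSums-mirror []      = refl
prefixSums-mirror (x ∷ σ) = begin
  prefixSums (mirror (x ∷ σ))                        ≡⟨ cong prefixSums (unfold-reverse (- x) (map -_ σ)) ⟩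
  prefixSums (m ∷ʳ - x)                              ≡⟨ cong (0ℤ ∷_) (partialSums-∷ʳ m (- x)) ⟩
  prefixSums m ∷ʳ (s + - x)                          ≡⟨ cong (_∷ʳ (s + - x)) (prefixSums-mirror σ) ⟩
  map (_+ s) (reverse P) ∷ʳ (s + - x)                ≡⟨ cong₂ _∷ʳ_ (map-cong shift (reverse P)) last ⟩
  map ((_+ s′) ∘ (x +_)) (reverse P) ∷ʳ (0ℤ + s′)    ≡⟨ cong (_∷ʳ (0ℤ + s′)) (map-∘ (reverse P)) ⟩
  map (_+ s′) (map (x +_) (reverse P)) ∷ʳ (0ℤ + s′)  ≡⟨ sym (map-++ (_+ s′) (map (x +_) (reverse P)) [ 0ℤ ]) ⟩
  map (_+ s′) (map (x +_) (reverse P) ∷ʳ 0ℤ)         ≡⟨ cong (map (_+ s′) ∘ (_∷ʳ 0ℤ)) (reverse-map (x +_) P) ⟩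
  map (_+ s′) (reverse (map (x +_) P) ∷ʳ 0ℤ)         ≡⟨ cong (map (_+ s′)) (sym (unfold-reverse 0ℤ (map (x +_) P))) ⟩
  map (_+ s′) (reverse (0ℤ ∷ map (x +_) P))          ≡⟨ cong (map (_+ s′) ∘ reverse) (sym (prefixSums-∷ x σ)) ⟩
  map (_+ s′) (reverse (prefixSums (x ∷ σ)))         ∎
  where
  open ≡-Reasoning
  m  = mirror σ
  s  = sum m
  s′ = sum (mirror (x ∷ σ))
  P  = prefixSums σ
  s′≡ : s′ ≡ s + - x
  s′≡ = trans (cong sum (unfold-reverse (- x) (map -_ σ))) (sum-∷ʳ m (- x))
  shift-cancel : ∀ a t c → t + c ≡ a + t + (c + - a)
  shift-cancel = solve-∀
  shift : ∀ t → t + s ≡ x + t + s′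
  shift t = trans (shift-cancel x t s) (cong (x + t +_) (sym s′≡))
  last : s + - x ≡ 0ℤ + s′
  last = trans (sym s′≡) (sym (+-identityˡ s′))

NonzeroSet : List ℤ → Set
NonzeroSet A = Unique A × All (_≢ 0ℤ) A

NonzeroSet-↭ : ∀ {x A′ A} → x ∷ A′ ↭ A → NonzeroSet A → NonzeroSet A′
NonzeroSet-↭ p (u , nz) with Unique-resp-↭ (↭-sym p) u | All-resp-↭ (↭-sym p) nz
... | _ ∷ u′ | _ ∷ nz′ = u′ , nz′

NonzeroSet-neg : ∀ {A} → NonzeroSet A → NonzeroSet (map -_ A)
NonzeroSet-neg (u , nz) =
  Unique.map⁺ neg-injective u , All.map⁺ (All.map (λ a≢0 → a≢0 ∘ neg-injective) nz)

positiveMember : ∀ A → All (_≢ 0ℤ) A → 0ℤ ≤ sum A → A ≢ [] →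
                 ∃₂ λ x A′ → x ∷ A′ ↭ A × 0ℤ < x
positiveMember []      _          _   A≢[] = contradiction refl A≢[]
positiveMember (a ∷ A) (a≢0 ∷ nz) 0≤s _ with 0ℤ <? a
... | yes 0<a = a , A , ↭-refl , 0<a
... | no  0≮a =
  let x , A′ , p , 0<x = positiveMember A nz (<⇒≤ 0<sumA) (λ { refl → <-irrefl refl 0<sumA }) in
  x , a ∷ A′ , ↭-trans (↭-swap x a ↭-refl) (↭-prep a p) , 0<x
  where
  0<sumA : 0ℤ < sum A
  0<sumA = ≤-<-trans 0≤s (subst (a + sum A <_) (+-identityˡ (sum A))
             (+-monoˡ-< (sum A) (≤∧≢⇒< (≮⇒≥ 0≮a) a≢0)))

-- If removing a positive x leaves a nonempty remainder of sum 0, then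
-- sum A = x and any other positive y can be removed instead: x ≠ y.
splitPositive : ∀ {A} → NonzeroSet A → 0ℤ < sum A →
                ∃₂ λ x A′ → x ∷ A′ ↭ A × 0ℤ < x × (sum A′ ≡ 0ℤ → A′ ≡ [])
splitPositive {A} (u , nz) 0<s
  with positiveMember A nz (<⇒≤ 0<s) (λ { refl → <-irrefl refl 0<s })
... | x , []    , p , 0<x = x , [] , p , 0<x , λ _ → refl
... | x , b ∷ B , p , 0<x with sum (b ∷ B) ≟ 0ℤ
...   | no  s≢0 = x , b ∷ B , p , 0<x , λ s≡0 → contradiction s≡0 s≢0
...   | yes s≡0 with positiveMember (b ∷ B) (All.tail (All-resp-↭ (↭-sym p) nz)) (≤-reflexive (sym s≡0)) (λ ())
...     | y , B′ , q , 0<y = y , x ∷ B′ , p′ , 0<y , λ e → contradiction (∙-cancelʳ (sum B′) y x (y≡x e)) y≢x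
  where
  p′ : y ∷ x ∷ B′ ↭ A
  p′ = ↭-trans (↭-swap y x ↭-refl) (↭-trans (↭-prep x q) p)
  y≢x : y ≢ x
  y≢x with Unique-resp-↭ (↭-sym p′) u
  ... | (y≢x ∷ _) ∷ _ = y≢x
  y≡x : x + sum B′ ≡ 0ℤ → y + sum B′ ≡ x + sum B′
  y≡x e = trans (sum-↭ q) (trans s≡0 (sym e))

OrderingAbove : ℤ → List ℤ → Set
OrderingAbove b A = ∃[ σ ] σ ↭ A × Unique (prefixSums σ) × All (b ≤_) (prefixSums σ)

emptyOrderingAbove : OrderingAbove 0ℤ []
emptyOrderingAbove = [] , ↭-refl , [] ∷ [] , ≤-refl ∷ []

∷-orderingAbove : ∀ {x A′ A b} → x ∷ A′ ↭ A → 0ℤ < x + b → OrderingAbove b A′ → OrderingAbove 0ℤ A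
∷-orderingAbove {x} p 0<x+b (τ , q , u , b≤) =
  x ∷ τ , ↭-trans (↭-prep x q) p ,
  subst Unique (sym (prefixSums-∷ x τ))
    (All.map⁺ (All.map (λ 0<x+t → <⇒≢ 0<x+t) positive) ∷ Unique.map⁺ (∙-cancelˡ x _ _) u) ,
  subst (All (0ℤ ≤_)) (sym (prefixSums-∷ x τ)) (≤-refl ∷ All.map⁺ (All.map <⇒≤ positive))
  where
  positive : All (λ t → 0ℤ < x + t) (prefixSums τ)
  positive = All.map (λ b≤t → <-≤-trans 0<x+b (+-monoʳ-≤ x b≤t)) b≤

mirror-orderingAbove : ∀ {A} → OrderingAbove 0ℤ (map -_ A) → OrderingAbove (sum A) A
mirror-orderingAbove {A} (τ , p , u , 0≤) =
  mirror τ , mirror-↭ p ,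
  subst Unique (sym (prefixSums-mirror τ))
    (Unique.map⁺ (∙-cancelʳ _ _ _) (Unique-resp-↭ (↭-sym (↭-reverse _)) u)) ,
  subst (All (sum A ≤_)) (sym (prefixSums-mirror τ))
    (All.map⁺ (All-resp-↭ (↭-sym (↭-reverse _)) (All.map shifted 0≤)))
  where
  shifted : ∀ {t} → 0ℤ ≤ t → sum A ≤ t + sum (mirror τ)
  shifted {t} 0≤t rewrite sum-↭ (mirror-↭ p) =
    subst (_≤ t + sum A) (+-identityˡ (sum A)) (+-monoˡ-≤ (sum A) 0≤t)

nonnegativeOrdering : ∀ {A} → NonzeroSet A → 0ℤ < sum A → OrderingAbove 0ℤ A
nonnegativeOrdering {A} = go (length A) refl
  where
  go : ∀ n {A} → length A ≡ n → NonzeroSet A → 0ℤ < sum A → OrderingAbove 0ℤ A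
  go zero    {[]} _   _ 0<0 = contradiction refl (<⇒≢ 0<0)
  go (suc n)      len h 0<s with splitPositive h 0<s
  ... | x , A′ , p , 0<x , empty with <-cmp (sum A′) 0ℤ
  ...   | tri< s′<0 _ _ = ∷-orderingAbove p 0<x+s′ (mirror-orderingAbove
            (go n (trans (length-map -_ A′) len′) (NonzeroSet-neg h′) 0<-s′))
    where
    0<x+s′ : 0ℤ < x + sum A′
    0<x+s′ = subst (0ℤ <_) (sym (sum-↭ p)) 0<s
    0<-s′ : 0ℤ < sum (map -_ A′)
    0<-s′ = subst (0ℤ <_) (sym (sum-map-neg A′)) (neg-mono-< s′<0)
    len′ : length A′ ≡ n
    len′ = ℕ.suc-injective (trans (↭-length p) len)
    h′ : NonzeroSet A′
    h′ = NonzeroSet-↭ p h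
  ...   | tri≈ _ s′≡0 _ = ∷-orderingAbove p (subst (0ℤ <_) (sym (+-identityʳ x)) 0<x)
            (subst (OrderingAbove 0ℤ) (sym (empty s′≡0)) emptyOrderingAbove)
  ...   | tri> _ _ 0<s′ = ∷-orderingAbove p (subst (0ℤ <_) (sym (+-identityʳ x)) 0<x)
            (go n (ℕ.suc-injective (trans (↭-length p) len)) (NonzeroSet-↭ p h) 0<s′)

zeroFreeOrdering : ∀ {A} → NonzeroSet A → sum A ≢ 0ℤ → ∃[ σ ] σ ↭ A × Unique (prefixSums σ)
zeroFreeOrdering {A} h s≢0 with <-cmp (sum A) 0ℤ
... | tri< s<0 _ _ =
  let σ , p , u , _ = mirror-orderingAbove (nonnegativeOrdering (NonzeroSet-neg h)
                        (subst (0ℤ <_) (sym (sum-map-neg A)) (neg-mono-< s<0)))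
  in σ , p , u
... | tri≈ _ s≡0 _ = contradiction s≡0 s≢0
... | tri> _ _ 0<s = let σ , p , u , _ = nonnegativeOrdering h 0<s in σ , p , u

∷ʳ-returningToZero : ∀ {τ A a} → τ ↭ A → a + sum A ≡ 0ℤ → Unique (prefixSums τ) →
                     Unique (partialSums (τ ∷ʳ a))
∷ʳ-returningToZero {τ} {A} {a} p a+s≡0 u =
  subst Unique (sym (trans (partialSums-∷ʳ τ a) (cong (partialSums τ ∷ʳ_) total≡0)))
    (Unique-resp-↭ (∷↭∷ʳ 0ℤ (partialSums τ)) u)
  where
  total≡0 : sum τ + a ≡ 0ℤ
  total≡0 = trans (cong (_+ a) (sum-↭ p)) (trans (+-comm (sum A) a) a+s≡0)

theorem3 : (A : List ℤ) → Unique A → All (λ a → a ≢ 0ℤ) A →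
    Σ[ σ ∈ List ℤ ] (σ ↭ A × Unique (partialSums σ))
theorem3 A u nz with sum A ≟ 0ℤ
theorem3 A u nz | no s≢0 with zeroFreeOrdering (u , nz) s≢0
... | σ , p , _ ∷ v = σ , p , v
theorem3 []      _       _          | yes _ = [] , ↭-refl , []
theorem3 (a ∷ A) (_ ∷ u) (a≢0 ∷ nz) | yes a+s≡0 =
  let τ , p , v = zeroFreeOrdering (u , nz) s≢0 in
  τ ∷ʳ a , ↭-trans (↭-sym (∷↭∷ʳ a τ)) (↭-prep a p) , ∷ʳ-returningToZero p a+s≡0 v
  where
  s≢0 : sum A ≢ 0ℤ
  s≢0 s≡0 = a≢0 (trans (sym (+-identityʳ a)) (trans (cong (a +_) (sym s≡0)) a+s≡0))
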